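{- Let $A$ be a finite set of words over a finite alphabet. If $\mathcal{L}_A$ is a transitive language, then there is a positive integer $r$ such that $per(\mathcal{L}_A)$ is a cofinite subset of $r\mathbb{Z}^+$.
   Context: Words are finite sequences over the alphabet; $|a|$ is the length, $ab$ concatenation, $a^n$ the $n$-fold concatenation. A factor of $b$ is a word $a$ with $b=cad$ for some (possibly empty) words $c,d$. $\mathcal{L}_A$ is the set of words with no factor in $A$. A language $\mathcal{L}$ is transitive if for all $a,b\in\mathcal{L}$ there is a (possibly empty) word $d$ with $adb\in\mathcal{L}$. A word $a\in\mathcal{L}$ is $k$-periodic in $\mathcal{L}$ if $|a|=k$ and $a^n\in\mathcal{L}$ for all $n\ge1$; $per(\mathcal{L})$ is the set of positive integers $k$ for which some word is $k$-periodic in $\mathcal{L}$. A set $S\subseteq r\mathbb{Z}^+$ is cofinite in $r\mathbb{Z}^+$ if $r\mathbb{Z}^+\setminus S$ is finite. -}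

module Defs where

open import Data.Nat using (ℕ; zero; suc; _≤_; _<_)
open import Data.Fin using (Fin)
open import Data.List using (List; []; _∷_; _++_; length)
open import Data.List.Membership.Propositional using (_∈_)
open import Data.Product using (Σ; ∃; ∃-syntax; _×_; _,_)
open import Relation.Binary.PropositionalEquality using (_≡_)
open import Relation.Nullary using (¬_)

Word : ℕ → Set
Word m = List (Fin m)

Factor : ∀ {m} → Word m → Word m → Set
Factor a b = ∃[ c ] ∃[ d ] (b ≡ c ++ a ++ d)

Language : ℕ → Set₁
Language m = Word m → Set

L : ∀ {m} → List (Word m) → Language m
L A w = ∀ a → a ∈ A → ¬ Factor a w

Transitive : ∀ {m} → Language m → Set
Transitive ℒ = ∀ a b → ℒ a → ℒ b → ∃[ d ] ℒ (a ++ d ++ b)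

_^ʷ_ : ∀ {m} → Word m → ℕ → Word m
a ^ʷ zero = []
a ^ʷ suc n = a ++ (a ^ʷ n)

Periodic : ∀ {m} → Language m → ℕ → Word m → Set
Periodic ℒ k a = ℒ a × length a ≡ k × (∀ n → 1 ≤ n → ℒ (a ^ʷ n))

Per : ∀ {m} → Language m → ℕ → Set
Per ℒ k = 0 < k × ∃[ a ] Periodic ℒ k a

CofiniteIn : (ℕ → Set) → ℕ → Set
CofiniteIn S r =
  (∀ k → S k → 0 < k × ∃[ q ] k ≡ q Data.Nat.* r)
  × ∃[ N ] (∀ q → 1 ≤ q → N ≤ q → S (q Data.Nat.* r))

{-# OPTIONS --safe #-}
-- Fix M ≥ 1 bounding the lengths of the forbidden words: two words of L_A that overlap in a word of
-- length ≥ M glue to a word of L_A. Fix also s ∈ L_A with |s| ≥ M. The return lengths |s e| with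
-- s e s ∈ L_A are periods and are closed under addition, and every period k comes with return lengths
-- c and c + k. A period longer than the number V of words of length M splits, by pigeonhole on the
-- windows of length M of a a a …, into two shorter periods. Hence the gcd r of finitely many return
-- lengths (any one, and those attached to the periods ≤ V) divides every period, while all large
-- multiples of r are return lengths.
module Submission where

open import Defs
open import Data.Fin using (Fin; toℕ)
import Data.Fin as Fin
open import Data.Fin.Properties using (pigeonhole; toℕ<n)
open import Data.List using (List; []; _∷_; _++_; length; map; concatMap; foldr; allFin; applyUpTo; upTo; lookup)
open import Data.List.Extrema.Nat using (max; xs≤max; v≤max⁺)
open import Data.List.Membership.Propositional using (_∈_)
open import Data.List.Membership.Propositional.Properties using (∈-map⁺; ∈-concatMap⁺; ∈-allFin; ∈-upTo⁺)
open import Data.List.Properties using (++-assoc; ++-identityʳ; ++-cancelˡ; ∷-injectiveˡ; ∷-injectiveʳ; length-++; length-++-≤ˡ; length-++-≤ʳ; length-applyUpTo)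
open import Data.List.Relation.Binary.Infix.Heterogeneous using (Infix; MkView; toView; fromView)
open import Data.List.Relation.Binary.Infix.Heterogeneous.Properties using (infix?)
open import Data.List.Relation.Binary.Pointwise using (Pointwise-≡⇒≡; ≡⇒Pointwise-≡)
open import Data.List.Relation.Unary.All using (All; []; _∷_; all?)
import Data.List.Relation.Unary.All as All
open import Data.List.Relation.Unary.Any using (here; there; index)
import Data.List.Relation.Unary.Any as Any
open import Data.List.Relation.Unary.Any.Properties using (lookup-index)
open import Data.Nat using (ℕ; zero; suc; _+_; _*_; _∸_; _/_; _%_; _≤_; _<_; z≤n; s≤s; z<s; _≤?_; _<?_; >-nonZero)
open import Data.Nat.Divisibility using (_∣_; divides; ∣-refl; ∣-trans; ∣m∣n⇒∣m+n; ∣m+n∣m⇒∣n; 0∣⇒≡0)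
open import Data.Nat.DivMod using (m≡m%n+[m/n]*n; m%n<n)
open import Data.Nat.GCD using (gcd; GCD; gcd-GCD; gcd[m,n]∣m; gcd[m,n]∣n; gcd[m,n]≢0; gcd-identityˡ; GCD-*; module Bézout)
open import Data.Nat.Induction using (<-rec)
open import Data.Nat.Properties
open import Data.Nat.Tactic.RingSolver using (solve-∀)
open import Data.Product using (∃-syntax; _×_; _,_; proj₁; proj₂)
open import Data.Sum using (_⊎_; inj₁; inj₂; [_,_]′)
open import Function using (_∘_)
open import Relation.Binary.PropositionalEquality using (_≡_; refl; sym; trans; cong; cong₂; subst; subst₂; module ≡-Reasoning)
open import Relation.Nullary using (Dec; yes; no; ¬?; contradiction)
open import Relation.Nullary.Decidable using (map′; _×-dec_)

module _ {ℓ} {X : Set ℓ} where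

  ++-prefix-by-length : ∀ (P Q C D : List X) → P ++ Q ≡ C ++ D → length C ≤ length P →
                        ∃[ E ] (P ≡ C ++ E)
  ++-prefix-by-length P Q [] D eq C≤P = P , refl
  ++-prefix-by-length (p ∷ P) Q (c ∷ C) D eq (s≤s C≤P) =
    let E , P≡CE = ++-prefix-by-length P Q C D (∷-injectiveʳ eq) C≤P
    in E , cong₂ _∷_ (∷-injectiveˡ eq) P≡CE

  ++-suffix-by-length : ∀ (P Q C D : List X) → P ++ Q ≡ C ++ D → length P ≤ length C →
                        ∃[ E ] (Q ≡ E ++ D)
  ++-suffix-by-length P Q C D eq P≤C =
    let E , C≡PE = ++-prefix-by-length C D P Q (sym eq) P≤C
    in E , ++-cancelˡ P Q (E ++ D) (begin
         P ++ Q        ≡⟨ eq ⟩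
         C ++ D        ≡⟨ cong (_++ D) C≡PE ⟩
         (P ++ E) ++ D ≡⟨ ++-assoc P E D ⟩
         P ++ E ++ D   ∎)
    where open ≡-Reasoning

  length-++-insert : ∀ (p q a r : List X) → length (p ++ (q ++ a) ++ r) ≡ length (p ++ q ++ r) + length a
  length-++-insert p q a r = begin
    length (p ++ (q ++ a) ++ r)                 ≡⟨ length-++ p ⟩
    length p + length ((q ++ a) ++ r)           ≡⟨ cong (length p +_) (length-++ (q ++ a)) ⟩
    length p + (length (q ++ a) + length r)     ≡⟨ cong (λ z → length p + (z + length r)) (length-++ q) ⟩
    length p + (length q + length a + length r) ≡⟨ shuffle (length p) (length q) (length a) (length r) ⟩
    length p + (length q + length r) + length a ≡⟨ cong (λ z → length p + z + length a) (length-++ q) ⟨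
    length p + length (q ++ r) + length a       ≡⟨ cong (_+ length a) (length-++ p) ⟨
    length (p ++ q ++ r) + length a             ∎
    where
    open ≡-Reasoning
    shuffle : ∀ P Q A R → P + (Q + A + R) ≡ P + (Q + R) + A
    shuffle = solve-∀

  pigeonhole-∈ : ∀ {xs : List X} (g : ℕ → X) → (∀ i → g i ∈ xs) →
                 ∃[ i ] ∃[ j ] (i < j × j ≤ length xs × g i ≡ g j)
  pigeonhole-∈ {xs} g g∈ =
    let i , j , i<j , same = pigeonhole (n<1+n (length xs)) (λ i → index (g∈ (toℕ i)))
    in toℕ i , toℕ j , i<j , ≤-pred (toℕ<n j) , (begin
         g (toℕ i)                      ≡⟨ lookup-index (g∈ (toℕ i)) ⟩
         lookup xs (index (g∈ (toℕ i))) ≡⟨ cong (lookup xs) same ⟩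
         lookup xs (index (g∈ (toℕ j))) ≡⟨ lookup-index (g∈ (toℕ j)) ⟨
         g (toℕ j)                      ∎)
    where open ≡-Reasoning

  applyUpTo-cong : ∀ {f g : ℕ → X} → (∀ n → f n ≡ g n) → ∀ l → applyUpTo f l ≡ applyUpTo g l
  applyUpTo-cong f≗g zero = refl
  applyUpTo-cong f≗g (suc l) = cong₂ _∷_ (f≗g 0) (applyUpTo-cong (f≗g ∘ suc) l)

  applyUpTo-+ : ∀ (f : ℕ → X) i l →
                applyUpTo f (i + l) ≡ applyUpTo f i ++ applyUpTo (λ n → f (i + n)) l
  applyUpTo-+ f zero l = refl
  applyUpTo-+ f (suc i) l = cong (f 0 ∷_) (applyUpTo-+ (f ∘ suc) i l)

  segment : (ℕ → X) → ℕ → ℕ → List X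
  segment f i l = applyUpTo (λ n → f (i + n)) l

  segment-+ : ∀ f i l l′ → segment f i (l + l′) ≡ segment f i l ++ segment f (i + l) l′
  segment-+ f i l l′ = trans (applyUpTo-+ _ l l′)
    (cong (segment f i l ++_) (applyUpTo-cong (λ n → cong f (sym (+-assoc i l n))) l′))

  segment-periodic : ∀ {f k} → (∀ n → f (k + n) ≡ f n) → ∀ i l → segment f (i + k) l ≡ segment f i l
  segment-periodic {f} {k} f-periodic i = applyUpTo-cong λ n → begin
    f (i + k + n)   ≡⟨ cong f (trans (cong (_+ n) (+-comm i k)) (+-assoc k i n)) ⟩
    f (k + (i + n)) ≡⟨ f-periodic (i + n) ⟩
    f (i + n)       ∎
    where open ≡-Reasoning

  -- cycleAfter y ys xs is the infinite sequence xs (y ∷ ys) (y ∷ ys) ...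
  cycleAfter : X → List X → List X → ℕ → X
  cycleAfter y ys []       zero    = y
  cycleAfter y ys []       (suc n) = cycleAfter y ys ys n
  cycleAfter y ys (x ∷ xs) zero    = x
  cycleAfter y ys (x ∷ xs) (suc n) = cycleAfter y ys xs n

  cycle : X → List X → ℕ → X
  cycle y ys = cycleAfter y ys []

  cycleAfter-+ : ∀ y ys xs n → cycleAfter y ys xs (length xs + n) ≡ cycle y ys n
  cycleAfter-+ y ys []       n = refl
  cycleAfter-+ y ys (x ∷ xs) n = cycleAfter-+ y ys xs n

  cycle-periodic : ∀ y ys n → cycle y ys (length (y ∷ ys) + n) ≡ cycle y ys n
  cycle-periodic y ys = cycleAfter-+ y ys ys

  applyUpTo-cycleAfter : ∀ y ys xs l →
                         applyUpTo (cycleAfter y ys xs) (length xs + l) ≡ xs ++ applyUpTo (cycle y ys) l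
  applyUpTo-cycleAfter y ys []       l = refl
  applyUpTo-cycleAfter y ys (x ∷ xs) l = cong (x ∷_) (applyUpTo-cycleAfter y ys xs l)

module _ {m : ℕ} where

  Factor-trans : ∀ {a b c : Word m} → Factor a b → Factor b c → Factor a c
  Factor-trans {a} (c , d , refl) (c′ , d′ , refl) = c′ ++ c , d ++ d′ , (begin
    c′ ++ (c ++ a ++ d) ++ d′ ≡⟨ cong (c′ ++_) (++-assoc c (a ++ d) d′) ⟩
    c′ ++ c ++ (a ++ d) ++ d′ ≡⟨ cong (λ z → c′ ++ c ++ z) (++-assoc a d d′) ⟩
    c′ ++ c ++ a ++ d ++ d′   ≡⟨ ++-assoc c′ c (a ++ d ++ d′) ⟨
    (c′ ++ c) ++ a ++ d ++ d′ ∎)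
    where open ≡-Reasoning

  factor-overlap : ∀ {a : Word m} x w y → length a ≤ length w → Factor a (x ++ w ++ y) →
                   Factor a (x ++ w) ⊎ Factor a (w ++ y)
  factor-overlap {a} x w y a≤w (c , d , eq) with length x ≤? length c
  ... | yes x≤c = let E , wy≡Ead = ++-suffix-by-length x (w ++ y) c (a ++ d) eq x≤c
                  in inj₂ (E , d , wy≡Ead)
  ... | no x≰c  = let E , xw≡caE = ++-prefix-by-length (x ++ w) y (c ++ a) d eq′ ca≤xw
                  in inj₁ (c , E , trans xw≡caE (++-assoc c a E))
    where
    eq′ : (x ++ w) ++ y ≡ (c ++ a) ++ d
    eq′ = trans (++-assoc x w y) (trans eq (sym (++-assoc c a d)))
    ca≤xw : length (c ++ a) ≤ length (x ++ w)
    ca≤xw = subst₂ _≤_ (sym (length-++ c)) (sym (length-++ x)) (+-mono-≤ (<⇒≤ (≰⇒> x≰c)) a≤w)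

  Infix⇒Factor : ∀ {a w : Word m} → Infix _≡_ a w → Factor a w
  Infix⇒Factor i with MkView c a≋ d ← toView i =
    c , d , cong (λ z → c ++ z ++ d) (sym (Pointwise-≡⇒≡ a≋))

  Factor⇒Infix : ∀ {a w : Word m} → Factor a w → Infix _≡_ a w
  Factor⇒Infix (c , d , refl) = fromView (MkView c (≡⇒Pointwise-≡ refl) d)

  factor? : (a w : Word m) → Dec (Factor a w)
  factor? a w = map′ Infix⇒Factor Factor⇒Infix (infix? Fin._≟_ a w)

  L? : (A : List (Word m)) (w : Word m) → Dec (L A w)
  L? A w = map′ (λ h a → All.lookup h) (λ h → All.tabulate (h _))
                (all? (λ a → ¬? (factor? a w)) A)

  words : ℕ → List (Word m)
  words zero    = [] ∷ []
  words (suc n) = concatMap (λ x → map (x ∷_) (words n)) (allFin m)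

  ∈-words : (w : Word m) → w ∈ words (length w)
  ∈-words []      = here refl
  ∈-words (x ∷ w) = ∈-concatMap⁺ (λ z → map (z ∷_) (words (length w)))
                      (Any.map (λ { refl → ∈-map⁺ (x ∷_) (∈-words w) }) (∈-allFin x))

  wordsUpTo : ℕ → List (Word m)
  wordsUpTo n = concatMap words (upTo (suc n))

  ∈-wordsUpTo : ∀ {w : Word m} {n} → length w ≤ n → w ∈ wordsUpTo n
  ∈-wordsUpTo {w} w≤n = ∈-concatMap⁺ words (Any.map (λ { refl → ∈-words w }) (∈-upTo⁺ (s≤s w≤n)))

  ^ʷ-sucʳ : ∀ (a : Word m) n → a ^ʷ suc n ≡ a ^ʷ n ++ a
  ^ʷ-sucʳ a zero    = ++-identityʳ a
  ^ʷ-sucʳ a (suc n) = trans (cong (a ++_) (^ʷ-sucʳ a n)) (sym (++-assoc a (a ^ʷ n) a))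

  length-^ʷ : ∀ (a : Word m) n → length (a ^ʷ n) ≡ n * length a
  length-^ʷ a zero    = refl
  length-^ʷ a (suc n) = trans (length-++ a) (cong (length a +_) (length-^ʷ a n))

  ^ʷ-conjugate : ∀ {v s u : Word m} → v ++ s ≡ s ++ u → ∀ n → v ^ʷ n ++ s ≡ s ++ u ^ʷ n
  ^ʷ-conjugate {v} {s} {u} vs≡su zero    = sym (++-identityʳ s)
  ^ʷ-conjugate {v} {s} {u} vs≡su (suc n) = begin
    (v ++ v ^ʷ n) ++ s ≡⟨ ++-assoc v (v ^ʷ n) s ⟩
    v ++ v ^ʷ n ++ s   ≡⟨ cong (v ++_) (^ʷ-conjugate vs≡su n) ⟩
    v ++ s ++ u ^ʷ n   ≡⟨ ++-assoc v s (u ^ʷ n) ⟨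
    (v ++ s) ++ u ^ʷ n ≡⟨ cong (_++ u ^ʷ n) vs≡su ⟩
    (s ++ u) ++ u ^ʷ n ≡⟨ ++-assoc s u (u ^ʷ n) ⟩
    s ++ u ^ʷ suc n    ∎
    where open ≡-Reasoning

  segment-factor : ∀ (f : ℕ → Fin m) i l n → i + l ≤ n → Factor (segment f i l) (applyUpTo f n)
  segment-factor f i l n i+l≤n =
    let o , i+l+o≡n = m≤n⇒∃[o]m+o≡n i+l≤n
    in applyUpTo f i , segment f (i + l) o , (begin
         applyUpTo f n                                         ≡⟨ cong (applyUpTo f) (sym i+l+o≡n) ⟩
         applyUpTo f (i + l + o)                               ≡⟨ cong (applyUpTo f) (+-assoc i l o) ⟩
         applyUpTo f (i + (l + o))                             ≡⟨ applyUpTo-+ f i (l + o) ⟩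
         applyUpTo f i ++ segment f i (l + o)                  ≡⟨ cong (applyUpTo f i ++_) (segment-+ f i l o) ⟩
         applyUpTo f i ++ segment f i l ++ segment f (i + l) o ∎)
    where open ≡-Reasoning

  applyUpTo-cycle : ∀ (y : Fin m) ys N → applyUpTo (cycle y ys) (N * length (y ∷ ys)) ≡ (y ∷ ys) ^ʷ N
  applyUpTo-cycle y ys zero    = refl
  applyUpTo-cycle y ys (suc N) = cong (y ∷_) (trans (applyUpTo-cycleAfter y ys ys (N * length (y ∷ ys)))
                                                     (cong (ys ++_) (applyUpTo-cycle y ys N)))

module Forbidden {m : ℕ} (A : List (Word m)) where

  M : ℕ
  M = max 1 (map length A)

  1≤M : 1 ≤ M
  1≤M = v≤max⁺ 1 (map length A) (inj₁ ≤-refl)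

  forbidden-length≤M : ∀ {a} → a ∈ A → length a ≤ M
  forbidden-length≤M a∈A = All.lookup (xs≤max 1 (map length A)) (∈-map⁺ length a∈A)

  L-factor : ∀ {w v} → Factor w v → L A v → L A w
  L-factor w⊑v Lv a a∈A a⊑w = Lv a a∈A (Factor-trans a⊑w w⊑v)

  L-prefix : ∀ x y → L A (x ++ y) → L A x
  L-prefix x y = L-factor ([] , y , refl)

  L-suffix : ∀ x y → L A (x ++ y) → L A y
  L-suffix x y = L-factor (x , [] , cong (x ++_) (sym (++-identityʳ y)))

  L-glue : ∀ x w y → M ≤ length w → L A (x ++ w) → L A (w ++ y) → L A (x ++ w ++ y)
  L-glue x w y M≤w Lxw Lwy a a∈A a⊑xwy =
    [ Lxw a a∈A , Lwy a a∈A ]′ (factor-overlap x w y (≤-trans (forbidden-length≤M a∈A) M≤w) a⊑xwy)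

  L-^ʷ-conjugate : ∀ {v s u} → M ≤ length s → L A (v ++ s) → v ++ s ≡ s ++ u → ∀ n → L A (v ^ʷ n ++ s)
  L-^ʷ-conjugate {v} {s} {u} M≤s Lvs vs≡su zero    = L-suffix v s Lvs
  L-^ʷ-conjugate {v} {s} {u} M≤s Lvs vs≡su (suc n) =
    subst (L A) vsuⁿ≡vⁿ⁺¹s (L-glue v s (u ^ʷ n) M≤s Lvs Lsuⁿ)
    where
    Lsuⁿ : L A (s ++ u ^ʷ n)
    Lsuⁿ = subst (L A) (^ʷ-conjugate vs≡su n) (L-^ʷ-conjugate M≤s Lvs vs≡su n)
    vsuⁿ≡vⁿ⁺¹s : v ++ s ++ u ^ʷ n ≡ v ^ʷ suc n ++ s
    vsuⁿ≡vⁿ⁺¹s = trans (cong (v ++_) (sym (^ʷ-conjugate vs≡su n))) (sym (++-assoc v (v ^ʷ n) s))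

  conjugate⇒Per : ∀ v s u → 0 < length v → M ≤ length s → L A (v ++ s) → v ++ s ≡ s ++ u →
                  Per (L A) (length v)
  conjugate⇒Per v s u v>0 M≤s Lvs vs≡su =
    v>0 , v , L-prefix v s Lvs , refl , λ n _ → L-prefix (v ^ʷ n) s (L-^ʷ-conjugate M≤s Lvs vs≡su n)

  long-word : Transitive (L A) → ∀ {w} → L A w → 0 < length w → ∀ t → ∃[ s ] (L A s × t ≤ length s)
  long-word T {w} Lw w>0 zero    = w , Lw , z≤n
  long-word T {w} Lw w>0 (suc t) =
    let s , Ls , t≤s = long-word T Lw w>0 t
        d , Lsdw     = T s w Ls Lw
    in s ++ d ++ w , Lsdw ,
       subst₂ _≤_ (+-comm t 1) (sym (length-++ s)) (+-mono-≤ t≤s (≤-trans w>0 (length-++-≤ʳ w {d})))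

  window : (ℕ → Fin m) → ℕ → Word m
  window f i = segment f i M

  equal-windows⇒Per : ∀ f → (∀ i l → L A (segment f i l)) →
                      ∀ i {d} → 0 < d → window f (i + d) ≡ window f i → Per (L A) d
  equal-windows⇒Per f Lf i {d} d>0 same =
    subst (Per (L A)) (length-applyUpTo _ d)
      (conjugate⇒Per v s u v>0 M≤s (subst (L A) (sym vs≡seg) (Lf i (d + M))) vs≡su)
    where
    v s u : Word m
    v = segment f i d
    s = window f i
    u = segment f (i + M) d
    v>0 : 0 < length v
    v>0 = subst (0 <_) (sym (length-applyUpTo _ d)) d>0
    M≤s : M ≤ length s
    M≤s = ≤-reflexive (sym (length-applyUpTo _ M))
    vs≡seg : v ++ s ≡ segment f i (d + M)
    vs≡seg = trans (cong (v ++_) (sym same)) (sym (segment-+ f i d M))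
    vs≡su : v ++ s ≡ s ++ u
    vs≡su = trans vs≡seg (trans (cong (segment f i) (+-comm d M)) (segment-+ f i M d))

  L-segment-cycle : ∀ {y ys} → (∀ n → 1 ≤ n → L A ((y ∷ ys) ^ʷ n)) →
                    ∀ i l → L A (segment (cycle y ys) i l)
  L-segment-cycle {y} {ys} Laⁿ i l =
    L-factor (segment-factor (cycle y ys) i l (N * length (y ∷ ys)) i+l≤Nk)
             (subst (L A) (sym (applyUpTo-cycle y ys N)) (Laⁿ N (s≤s z≤n)))
    where
    N : ℕ
    N = suc (i + l)
    i+l≤Nk : i + l ≤ N * length (y ∷ ys)
    i+l≤Nk = ≤-trans (n≤1+n (i + l)) (m≤m*n N (length (y ∷ ys)))

  V : ℕ
  V = length (words {m} M)

  window∈words : ∀ f i → window f i ∈ words M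
  window∈words f i = subst (λ l → window f i ∈ words l) (length-applyUpTo _ M) (∈-words (window f i))

  -- Two of the V + 1 windows at positions 0 … V of the periodic sequence a a a … coincide, at
  -- positions I < J; then both J - I and |a| - (J - I) are periods.
  Per-split : ∀ {k} → Per (L A) k → V < k → ∃[ d ] ∃[ e ] (d + e ≡ k × Per (L A) d × Per (L A) e)
  Per-split (_ , y ∷ ys , _ , refl , Laⁿ) V<k
    with I , J , I<J , J≤V , WI≡WJ ← pigeonhole-∈ (window (cycle y ys)) (window∈words (cycle y ys)) =
    d , e , d+e≡k ,
    equal-windows⇒Per f Lf I d>0 (trans (cong (window f) I+d≡J) (sym WI≡WJ)) ,
    equal-windows⇒Per f Lf J e>0 WJ+e≡WJ
    where
    k d e : ℕ
    k = length (y ∷ ys)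
    d = J ∸ I
    e = k ∸ d
    f : ℕ → Fin m
    f = cycle y ys
    Lf : ∀ i l → L A (segment f i l)
    Lf = L-segment-cycle Laⁿ
    I+d≡J : I + d ≡ J
    I+d≡J = m+[n∸m]≡n (<⇒≤ I<J)
    d>0 : 0 < d
    d>0 = m<n⇒0<n∸m I<J
    d<k : d < k
    d<k = ≤-<-trans (m∸n≤m J I) (≤-<-trans J≤V V<k)
    e>0 : 0 < e
    e>0 = m<n⇒0<n∸m d<k
    d+e≡k : d + e ≡ k
    d+e≡k = m+[n∸m]≡n (<⇒≤ d<k)
    WJ+e≡WJ : window f (J + e) ≡ window f J
    WJ+e≡WJ = begin
      window f (J + e)     ≡⟨ cong (λ j → window f (j + e)) I+d≡J ⟨
      window f (I + d + e) ≡⟨ cong (window f) (trans (+-assoc I d e) (cong (I +_) d+e≡k)) ⟩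
      window f (I + k)     ≡⟨ segment-periodic (cycle-periodic y ys) I M ⟩
      window f I           ≡⟨ WI≡WJ ⟩
      window f J           ∎
      where open ≡-Reasoning

  Per-∣ : ∀ {g} → (∀ {k} → k ≤ V → Per (L A) k → g ∣ k) → ∀ {k} → Per (L A) k → g ∣ k
  Per-∣ {g} short {k} = <-rec (λ k → Per (L A) k → g ∣ k) step k
    where
    step : ∀ k → (∀ {j} → j < k → Per (L A) j → g ∣ j) → Per (L A) k → g ∣ k
    step k rec Pk with k ≤? V
    ... | yes k≤V = short k≤V Pk
    ... | no k≰V  =
      let d , e , d+e≡k , Pd , Pe = Per-split Pk (≰⇒> k≰V)
          d<k = subst (d <_) d+e≡k (m<m+n d (proj₁ Pe))
          e<k = subst (e <_) d+e≡k (m<n+m e (proj₁ Pd))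
      in subst (g ∣_) d+e≡k (∣m∣n⇒∣m+n (rec d<k Pd) (rec e<k Pe))

module Returns {m : ℕ} (A : List (Word m)) (T : Transitive (L A)) {s : Word m} (Ls : L A s)
               (M≤s : Forbidden.M A ≤ length s) where
  open Forbidden A

  Return : ℕ → Set
  Return n = ∃[ e ] (L A (s ++ e ++ s) × length (s ++ e) ≡ n)

  return-via : ∀ d₁ w d₂ → M ≤ length w → L A (s ++ d₁ ++ w) → L A (w ++ d₂ ++ s) →
               Return (length (s ++ d₁ ++ w ++ d₂))
  return-via d₁ w d₂ M≤w Lsd₁w Lwd₂s =
    d₁ ++ w ++ d₂ , subst (L A) reassoc (L-glue (s ++ d₁) w (d₂ ++ s) M≤w Lsd₁w′ Lwd₂s) , refl
    where
    Lsd₁w′ : L A ((s ++ d₁) ++ w)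
    Lsd₁w′ = subst (L A) (sym (++-assoc s d₁ w)) Lsd₁w
    reassoc : (s ++ d₁) ++ w ++ d₂ ++ s ≡ s ++ (d₁ ++ w ++ d₂) ++ s
    reassoc = trans (++-assoc s d₁ (w ++ d₂ ++ s))
                    (cong (s ++_) (sym (trans (++-assoc d₁ (w ++ d₂) s) (cong (d₁ ++_) (++-assoc w d₂ s)))))

  Return-+ : ∀ {x y} → Return x → Return y → Return (x + y)
  Return-+ (e₁ , Lse₁s , refl) (e₂ , Lse₂s , refl) =
    subst Return split (return-via e₁ s e₂ M≤s Lse₁s Lse₂s)
    where
    split : length (s ++ e₁ ++ s ++ e₂) ≡ length (s ++ e₁) + length (s ++ e₂)
    split = trans (cong length (sym (++-assoc s e₁ (s ++ e₂)))) (length-++ (s ++ e₁))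

  Return⇒Per : ∀ {n} → Return n → Per (L A) n
  Return⇒Per (e , Lses , refl) =
    conjugate⇒Per (s ++ e) s (e ++ s) (≤-trans 1≤M (≤-trans M≤s (length-++-≤ˡ s))) M≤s
                  (subst (L A) (sym (++-assoc s e s)) Lses) (++-assoc s e s)

  return₀ : ∃[ c ] Return c
  return₀ = let d , Lsds = T s s Ls Ls in length (s ++ d) , d , Lsds , refl

  -- Route s → a^M → s, once as it stands and once with one more copy of a spliced in.
  Return-around : ∀ {a} → 0 < length a → L A (a ^ʷ suc M) →
                  ∃[ c ] (Return c × Return (c + length a))
  Return-around {a} a>0 Laᴹ⁺¹ =
    length (s ++ d₁ ++ w ++ d₂) , return-via d₁ w d₂ M≤w Lsd₁w Lwd₂s ,
    subst Return (length-++-insert s d₁ a (w ++ d₂)) (return-via (d₁ ++ a) w d₂ M≤w Lsd₁aw Lwd₂s)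
    where
    w : Word m
    w = a ^ʷ M
    M≤w : M ≤ length w
    M≤w = subst (M ≤_) (sym (length-^ʷ a M)) (m≤m*n M (length a) {{>-nonZero a>0}})
    Lw : L A w
    Lw = L-suffix a w Laᴹ⁺¹
    d₁ d₂ : Word m
    d₁ = proj₁ (T s w Ls Lw)
    d₂ = proj₁ (T w s Lw Ls)
    Lsd₁w : L A (s ++ d₁ ++ w)
    Lsd₁w = proj₂ (T s w Ls Lw)
    Lwd₂s : L A (w ++ d₂ ++ s)
    Lwd₂s = proj₂ (T w s Lw Ls)
    Lsd₁aw : L A (s ++ (d₁ ++ a) ++ w)
    Lsd₁aw = subst (L A) reassoc (L-glue (s ++ d₁) w a M≤w Lsd₁w′ (subst (L A) (^ʷ-sucʳ a M) Laᴹ⁺¹))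
      where
      Lsd₁w′ : L A ((s ++ d₁) ++ w)
      Lsd₁w′ = subst (L A) (sym (++-assoc s d₁ w)) Lsd₁w
      reassoc : (s ++ d₁) ++ w ++ a ≡ s ++ (d₁ ++ a) ++ w
      reassoc = begin
        (s ++ d₁) ++ w ++ a ≡⟨ ++-assoc s d₁ (w ++ a) ⟩
        s ++ d₁ ++ w ++ a   ≡⟨ cong (λ z → s ++ d₁ ++ z) (^ʷ-sucʳ a M) ⟨
        s ++ d₁ ++ a ++ w   ≡⟨ cong (s ++_) (++-assoc d₁ a w) ⟨
        s ++ (d₁ ++ a) ++ w ∎
        where open ≡-Reasoning

  record ReturnPairs (as : List (Word m)) : Set where
    field
      lengths : List ℕ
      returns : All Return lengths
      pair    : ∀ {a} → a ∈ as → 0 < length a → L A (a ^ʷ suc M) →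
                ∃[ c ] (c ∈ lengths × c + length a ∈ lengths)

  returnPairs : ∀ as → ReturnPairs as
  returnPairs []       = record { lengths = [] ; returns = [] ; pair = λ () }
  returnPairs (a ∷ as) with 0 <? length a ×-dec L? A (a ^ʷ suc M)
  ... | no ¬cyclic = record
    { lengths = lengths
    ; returns = returns
    ; pair    = λ { (here refl) a>0 La → contradiction (a>0 , La) ¬cyclic ; (there a∈) → pair a∈ }
    }
    where open ReturnPairs (returnPairs as)
  ... | yes (a>0 , La) with c , Rc , Rca ← Return-around a>0 La = record
    { lengths = c ∷ c + length a ∷ lengths
    ; returns = Rc ∷ Rca ∷ returns
    ; pair    = λ { (here refl) _ _ → c , here refl , there (here refl)
                  ; (there b∈) b>0 Lb → let c′ , c′∈ , c′b∈ = pair b∈ b>0 Lb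
                                        in c′ , there (there c′∈) , there (there c′b∈) }
    }
    where open ReturnPairs (returnPairs as)

  returnLengths : List ℕ
  returnLengths = ReturnPairs.lengths (returnPairs (wordsUpTo V))

  returnLengths-Return : All Return returnLengths
  returnLengths-Return = ReturnPairs.returns (returnPairs (wordsUpTo V))

  short-Per-∣ : ∀ {g} → (∀ {x} → x ∈ returnLengths → g ∣ x) →
                ∀ {k} → k ≤ V → Per (L A) k → g ∣ k
  short-Per-∣ g∣ k≤V (k>0 , a , _ , refl , Laⁿ) =
    let c , c∈ , ca∈ = ReturnPairs.pair (returnPairs (wordsUpTo V)) (∈-wordsUpTo k≤V) k>0
                                        (Laⁿ (suc M) (s≤s z≤n))
    in ∣m+n∣m⇒∣n (g∣ ca∈) (g∣ c∈)

Eventually : (ℕ → Set) → Set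
Eventually P = ∃[ N ] (∀ q → N ≤ q → P q)

-- Writing v = 1 + ρ + e turns the claim into a semiring identity plus one use of the Bézout equation.
combination-identity : ∀ K N {u v} α β ρ e t → suc ρ + e ≡ v → suc (β * v) ≡ α * u →
  K * u + (N + v * β) * v + (ρ + t * v) ≡ (K + ρ * α) * u + (N + (suc e * β + t)) * v
combination-identity K N {u} α β ρ e t refl bezout = begin
  K * u + (N + v * β) * v + (ρ + t * v)                ≡⟨ expand K N u β ρ e t ⟩
  K * u + ρ * suc (β * v) + (N + (suc e * β + t)) * v  ≡⟨ cong (λ z → K * u + ρ * z + R) bezout ⟩
  K * u + ρ * (α * u) + (N + (suc e * β + t)) * v      ≡⟨ collect K N u α β ρ e t ⟩
  (K + ρ * α) * u + (N + (suc e * β + t)) * v          ∎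
  where
  open ≡-Reasoning
  v R : ℕ
  v = suc ρ + e
  R = (N + (suc e * β + t)) * v
  expand : ∀ K N u β ρ e t → K * u + (N + (suc ρ + e) * β) * (suc ρ + e) + (ρ + t * (suc ρ + e))
                           ≡ K * u + ρ * suc (β * (suc ρ + e)) + (N + (suc e * β + t)) * (suc ρ + e)
  expand = solve-∀
  collect : ∀ K N u α β ρ e t → K * u + ρ * (α * u) + (N + (suc e * β + t)) * (suc ρ + e)
                               ≡ (K + ρ * α) * u + (N + (suc e * β + t)) * (suc ρ + e)
  collect = solve-∀

eventually-combination : ∀ K N {u v α β} → 0 < v → suc (β * v) ≡ α * u →
                         Eventually (λ q → ∃[ a ] ∃[ b ] (q ≡ (K + a) * u + (N + b) * v))
eventually-combination K N {u} {v@(suc _)} {α} {β} _ bezout =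
  Q , λ q Q≤q → subst (λ q → ∃[ a ] ∃[ b ] (q ≡ (K + a) * u + (N + b) * v)) (m+[n∸m]≡n Q≤q)
                       (combination (q ∸ Q))
  where
  Q : ℕ
  Q = K * u + (N + v * β) * v
  combination : ∀ z → ∃[ a ] ∃[ b ] (Q + z ≡ (K + a) * u + (N + b) * v)
  combination z =
    let ρ = z % v
        t = z / v
        e , 1+ρ+e≡v = m≤n⇒∃[o]m+o≡n (m%n<n z v)
    in ρ * α , suc e * β + t ,
       trans (cong (Q +_) (m≡m%n+[m/n]*n z v)) (combination-identity K N α β ρ e t 1+ρ+e≡v bezout)

eventually-coprime-combination : ∀ K N {u v} → 0 < u → 0 < v → Bézout.Identity 1 u v →
                                 Eventually (λ q → ∃[ a ] ∃[ b ] (q ≡ (K + a) * u + (N + b) * v))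
eventually-coprime-combination K N u>0 v>0 (Bézout.+- α β eq) =
  eventually-combination K N {α = α} {β} v>0 eq
eventually-coprime-combination K N {u} {v} u>0 v>0 (Bézout.-+ α β eq) =
  let Q , combination = eventually-combination N K {v} {u} {β} {α} u>0 eq
  in Q , λ q Q≤q → let b , a , q≡ = combination q Q≤q
                   in a , b , trans q≡ (+-comm ((N + b) * v) ((K + a) * u))

foldr-gcd∣ : ∀ g xs {x} → x ∈ g ∷ xs → foldr gcd g xs ∣ x
foldr-gcd∣ g []       (here refl)         = ∣-refl
foldr-gcd∣ g (y ∷ ys) (here refl)         = ∣-trans (gcd[m,n]∣n y _) (foldr-gcd∣ g ys (here refl))
foldr-gcd∣ g (y ∷ ys) (there (here refl)) = gcd[m,n]∣m y _
foldr-gcd∣ g (y ∷ ys) (there (there x∈))  = ∣-trans (gcd[m,n]∣n y _) (foldr-gcd∣ g ys (there x∈))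

foldr-gcd>0 : ∀ {g} → 0 < g → ∀ xs → 0 < foldr gcd g xs
foldr-gcd>0 g>0 []       = g>0
foldr-gcd>0 g>0 (x ∷ xs) = n≢0⇒n>0 (gcd[m,n]≢0 x _ (inj₂ (n>0⇒n≢0 (foldr-gcd>0 g>0 xs))))

module AdditivelyClosed (S : ℕ → Set) (S-+ : ∀ {x y} → S x → S y → S (x + y)) where

  S-* : ∀ {x} → S x → ∀ b → S (suc b * x)
  S-* {x} Sx zero    = subst S (sym (+-identityʳ x)) Sx
  S-* {x} Sx (suc b) = S-+ Sx (S-* Sx b)

  eventually-multiples : ∀ {x} → S x → Eventually (λ q → S (q * x))
  eventually-multiples Sx = 1 , λ { (suc q) _ → S-* Sx q }

  eventually-multiples-GCD : ∀ {x y g} → GCD x y g → 0 < x → 0 < y → S x →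
                             Eventually (λ q → S (q * y)) → Eventually (λ q → S (q * g))
  eventually-multiples-GCD {g = zero} G x>0 _ _ _ = contradiction (0∣⇒≡0 (GCD.gcd∣m G)) (n>0⇒n≢0 x>0)
  eventually-multiples-GCD {g = g@(suc _)} G x>0 y>0 Sx (N , Sqy)
    with divides u refl ← GCD.gcd∣m G | divides v refl ← GCD.gcd∣n G =
    let Q , combination =
          eventually-coprime-combination 1 N (positive-factor x>0) (positive-factor y>0) bezout
    in Q , λ q Q≤q → let a , b , q≡ = combination q Q≤q
                     in subst S (sym (trans (cong (_* g) q≡) (distribute a u N b v g)))
                              (S-+ (S-* Sx a) (Sqy (N + b) (m≤m+n N b)))
    where
    positive-factor : ∀ {w} → 0 < w * g → 0 < w
    positive-factor {suc _} _ = z<s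
    bezout : Bézout.Identity 1 u v
    bezout = Bézout.identity (GCD-* (subst (GCD (u * g) (v * g)) (sym (*-identityˡ g)) G))
    distribute : ∀ a u N b v g → ((1 + a) * u + (N + b) * v) * g ≡ suc a * (u * g) + (N + b) * (v * g)
    distribute = solve-∀

  eventually-multiples-foldr-gcd : ∀ {g} → 0 < g → Eventually (λ q → S (q * g)) →
                                   ∀ {xs} → All S xs → Eventually (λ q → S (q * foldr gcd g xs))
  eventually-multiples-foldr-gcd g>0 Sg [] = Sg
  eventually-multiples-foldr-gcd g>0 Sg {zero ∷ xs} (_ ∷ Sxs) =
    subst (λ h → Eventually (λ q → S (q * h))) (sym (gcd-identityˡ _))
          (eventually-multiples-foldr-gcd g>0 Sg Sxs)
  eventually-multiples-foldr-gcd g>0 Sg {suc x ∷ xs} (Sx ∷ Sxs) =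
    eventually-multiples-GCD (gcd-GCD _ _) z<s (foldr-gcd>0 g>0 xs) Sx
                             (eventually-multiples-foldr-gcd g>0 Sg Sxs)

theorem9 : (m : ℕ) (A : List (Word m)) →
    Transitive (L A) →
    (∃[ w ] (L A w × 0 < length w)) →
    ∃[ r ] (0 < r × CofiniteIn (Per (L A)) r)
theorem9 m A T (w , Lw , w>0) with s , Ls , M≤s ← Forbidden.long-word A T Lw w>0 (Forbidden.M A) =
  r , foldr-gcd>0 c₀>0 returnLengths ,
  (λ k Pk → proj₁ Pk , quotient (Per-∣ (short-Per-∣ (r∣ ∘ there)) Pk)) ,
  proj₁ eventually , λ q _ Q≤q → Return⇒Per (proj₂ eventually q Q≤q)
  where
  open Forbidden A
  open Returns A T Ls M≤s
  open AdditivelyClosed Return Return-+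
  c₀ r : ℕ
  c₀ = proj₁ return₀
  r = foldr gcd c₀ returnLengths
  c₀>0 : 0 < c₀
  c₀>0 = proj₁ (Return⇒Per (proj₂ return₀))
  r∣ : ∀ {x} → x ∈ c₀ ∷ returnLengths → r ∣ x
  r∣ = foldr-gcd∣ c₀ returnLengths
  quotient : ∀ {k} → r ∣ k → ∃[ q ] (k ≡ q * r)
  quotient (divides q k≡qr) = q , k≡qr
  eventually : Eventually (λ q → Return (q * r))
  eventually =
    eventually-multiples-foldr-gcd c₀>0 (eventually-multiples (proj₂ return₀)) returnLengths-Return
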